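{- Let $Q$ be a quiver on $[4]$ such that every pair of distinct vertices is connected by at least one arrow. If $Q$ contains a cyclic triangle of type different from $(1,1,2)$, then $Q$ is mutation-infinite.
   Context: A quiver is a finite directed multigraph without loops and directed $2$-cycles, with adjacency matrix $b_{i,j}=$ #(arrows $i\to j$) $-$ #(arrows $j\to i$). Mutation $\mu_k$: $b'_{i,j}=-b_{i,j}$ if $k\in\{i,j\}$, else $b'_{i,j}=b_{i,j}+\frac{|b_{i,k}|b_{k,j}+b_{i,k}|b_{k,j}|}{2}$. A quiver is mutation-infinite if infinitely many non-isomorphic quivers are mutation equivalent to it. A cyclic triangle of type $(a,b,c)$ in $Q$ is a triple of vertices $i,j,k$ with exactly $a$ arrows $i\to j$, $b$ arrows $j\to k$ and $c$ arrows $k\to i$ ($a,b,c\ge1$); types are considered up to cyclic rotation. -}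

module Defs where

open import Data.Nat using (ℕ; _≥_)
open import Data.Integer using (ℤ; +_; -_; _+_; _*_; ∣_∣)
open import Data.Integer.DivMod using (_/ℕ_)
open import Data.Fin using (Fin)
open import Data.Fin.Permutation using (Permutation′; _⟨$⟩ʳ_)
open import Data.List using (List; []; _∷_)
open import Data.Product using (Σ; ∃; _×_; _,_)
open import Data.Sum using (_⊎_)
open import Relation.Nullary using (¬_; Dec; yes; no)
open import Relation.Binary.PropositionalEquality using (_≡_; _≢_)
import Data.Fin as F

-- A quiver on the vertex set [4] = Fin 4, encoded by its exchange
-- (adjacency) matrix b i j = #(i→j) − #(j→i).  Quivers without loops
-- and 2-cycles correspond exactly to skew-symmetric integer matrices.
Matrix : Set
Matrix = Fin 4 → Fin 4 → ℤ

IsSkew : Matrix → Set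
IsSkew b = ∀ i j → b i j ≡ - b j i

-- Mutation μ_k, literally as in the paper (the numerator is always even).
mutate : Fin 4 → Matrix → Matrix
mutate k b i j with i F.≟ k | j F.≟ k
... | yes _ | _     = - b i j
... | no _  | yes _ = - b i j
... | no _  | no _  =
  b i j + ((+ ∣ b i k ∣) * b k j + b i k * (+ ∣ b k j ∣)) /ℕ 2

mutateSeq : List (Fin 4) → Matrix → Matrix
mutateSeq []       b = b
mutateSeq (k ∷ ks) b = mutateSeq ks (mutate k b)

MutEquiv : Matrix → Matrix → Set
MutEquiv b b' = Σ (List (Fin 4)) λ ks → ∀ i j → mutateSeq ks b i j ≡ b' i j

Isomorphic : Matrix → Matrix → Set
Isomorphic b b' = Σ (Permutation′ 4) λ σ → ∀ i j → b' (σ ⟨$⟩ʳ i) (σ ⟨$⟩ʳ j) ≡ b i j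

MutationInfinite : Matrix → Set
MutationInfinite b =
  ∀ (n : ℕ) → Σ (Fin n → Matrix) λ f →
    (∀ m → MutEquiv b (f m)) × (∀ m m' → m ≢ m' → ¬ Isomorphic (f m) (f m'))

Complete : Matrix → Set
Complete b = ∀ i j → i ≢ j → b i j ≢ + 0

CyclicTriangle : Matrix → ℕ → ℕ → ℕ → Set
CyclicTriangle B a b c =
  a ≥ 1 × b ≥ 1 × c ≥ 1 ×
  Σ (Fin 4) λ i → Σ (Fin 4) λ j → Σ (Fin 4) λ k →
    B i j ≡ + a × B j k ≡ + b × B k i ≡ + c

Is112 : ℕ → ℕ → ℕ → Set
Is112 a b c = (a ≡ 1 × b ≡ 1 × c ≡ 2) ⊎ (a ≡ 1 × b ≡ 2 × c ≡ 1) ⊎ (a ≡ 2 × b ≡ 1 × c ≡ 1)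

-- A cyclic triangle of type (x, y, z) with x, y, z ≥ 2, not (2, 2, 2), behaves like a Markov
-- triple: with z the smallest weight, mutating at the vertex between the x and y arrows turns
-- the triangle into one of type (xy − z, y, x), and xy − z exceeds max(x, y).  Iterating, the
-- weights grow without bound, and since the largest |b_ij| is an isomorphism invariant the
-- mutation class is infinite.  The other cyclic types apart from (1,1,1), (1,1,2), (2,2,2)
-- reach such a triangle after one or two mutations, and an acyclic triangle with weights
-- p : s → m, q : m → t, r : s → t becomes cyclic of type (r + pq, q, p) after mutating at m.
-- Hence a complete quiver on four vertices with an edge of weight ≥ 3 is mutation-infinite.
-- In the remaining case every b_ij lies in {±1, ±2}, and the 4⁶ such quivers are checked by
-- evaluation: whenever one contains a cyclic triangle not of type (1,1,2), at most three
-- mutations produce a cyclic triangle of none of the three mutation-finite types.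
module Submission where

open import Defs
open import Data.Nat.Base
  using (ℕ; zero; suc; _+_; _*_; _∸_; _⊔_; _≤_; _<_; z≤n; s≤s; >-nonZero)
open import Data.Nat.Properties as ℕₚ
  using (_≤?_; ≤-refl; ≤-trans; <-trans; ≤-total; ≤-antisym; +-suc; +-comm; *-comm;
         m≤m+n; m≤n+m; m≤m*n; m≤m⊔n; m≤n⊔m; ⊔-lub; +-mono-≤; +-monoʳ-≤; +-monoˡ-<;
         +-monoʳ-<; m+[n∸m]≡n; m+n∸m≡n; m+n≤o⇒m≤o∸n; <⇒≢; ≰⇒>; m≤n⇒m<n∨m≡n)
open import Data.Nat.DivMod using (_/_; _%_; m*n/n≡m; m*n%n≡0)
open import Data.Integer.Base as ℤ using (ℤ; +_; -_; ∣_∣; +[1+_]; -[1+_]; _⊖_; _/ℕ_)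
import Data.Integer.Properties as ℤₚ
open import Data.Fin.Base as Fin using (Fin; toℕ)
open import Data.Fin.Patterns using (0F; 1F; 2F; 3F)
import Data.Fin.Properties as Finₚ
open import Data.Fin.Permutation using (_⟨$⟩ˡ_; inverseʳ)
open import Data.List.Base using (List; []; _∷_; [_]; _++_; map; concatMap)
open import Data.List.Membership.Propositional using (_∈_)
open import Data.List.Relation.Unary.All as All using (All)
open import Data.List.Relation.Unary.Any as Any using (Any; here; there)
open import Data.Product.Base using (Σ; ∃; _×_; _,_; proj₁; proj₂)
open import Data.Product.Properties using (≡-dec)
open import Data.Sum.Base using (_⊎_; inj₁; inj₂)
open import Function.Base using (_∘_)
open import Relation.Binary.Definitions using (tri<; tri≈; tri>)
open import Relation.Binary.PropositionalEquality
  using (_≡_; _≢_; refl; sym; trans; cong; cong₂; subst; module ≡-Reasoning)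
open import Relation.Nullary using (¬_; Dec; yes; no; contradiction)
open import Relation.Nullary.Decidable using (_×-dec_; _⊎-dec_; _→-dec_; ¬?; map′; toWitness)

private variable
  A B M : Matrix
  i j k u v w s m t : Fin 4
  n x y z p q r : ℕ

infix 4 _≐_

_≐_ : Matrix → Matrix → Set
A ≐ B = ∀ i j → A i j ≡ B i j

record Arrows (M : Matrix) (i j : Fin 4) (n : ℕ) : Set where
  constructor arrows
  field
    forward  : M i j ≡ + n
    backward : M j i ≡ - + n

open Arrows

Cycle : Matrix → (u v w : Fin 4) → (x y z : ℕ) → Set
Cycle M u v w x y z = Arrows M u v x × Arrows M v w y × Arrows M w u z

Acyclic : Matrix → (s m t : Fin 4) → (p q r : ℕ) → Set
Acyclic M s m t p q r = Arrows M s m p × Arrows M m t q × Arrows M s t r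

Cycle-rotate : Cycle M u v w x y z → Cycle M v w u y z x
Cycle-rotate (uv , vw , wu) = vw , wu , uv

Arrows-≐ : A ≐ B → Arrows A i j n → Arrows B i j n
Arrows-≐ {i = i} {j} A≐B (arrows e e′) = arrows (trans (sym (A≐B i j)) e) (trans (sym (A≐B j i)) e′)

Cycle-≐ : A ≐ B → Cycle A u v w x y z → Cycle B u v w x y z
Cycle-≐ A≐B (uv , vw , wu) = Arrows-≐ A≐B uv , Arrows-≐ A≐B vw , Arrows-≐ A≐B wu

skew⇒Arrows : IsSkew M → M i j ≡ + n → Arrows M i j n
skew⇒Arrows {i = i} {j} skew e = arrows e (trans (skew j i) (cong -_ e))

skew⇒diagonal≡0 : IsSkew M → ∀ i → M i i ≡ + 0
skew⇒diagonal≡0 {M} skew i = self-negative (M i i) (skew i i)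
  where
  self-negative : ∀ a → a ≡ - a → a ≡ + 0
  self-negative (+ zero) _ = refl

Arrows⇒≢ : Arrows M i j n → 1 ≤ n → i ≢ j
Arrows⇒≢ (arrows e e′) (s≤s _) refl with trans (sym e) e′
... | ()

orientation : IsSkew M → M i j ≢ + 0 → Arrows M i j ∣ M i j ∣ ⊎ Arrows M j i ∣ M i j ∣
orientation {M} {i} {j} skew M≢0 with M i j in e
... | + zero   = contradiction refl M≢0
... | +[1+ n ] = inj₁ (skew⇒Arrows skew e)
... | -[1+ n ] = inj₂ (arrows (trans (skew j i) (cong -_ e)) e)

≢0⇒1≤∣∣ : ∀ {a} → a ≢ + 0 → 1 ≤ ∣ a ∣
≢0⇒1≤∣∣ {+ zero}   a≢0 = contradiction refl a≢0
≢0⇒1≤∣∣ {+[1+ _ ]} _   = s≤s z≤n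
≢0⇒1≤∣∣ { -[1+ _ ]} _   = s≤s z≤n

mutationTerm : ℤ → ℤ → ℤ
mutationTerm a b = ((+ ∣ a ∣) ℤ.* b ℤ.+ a ℤ.* (+ ∣ b ∣)) /ℕ 2

mutate-≐ : ∀ k → A ≐ B → mutate k A ≐ mutate k B
mutate-≐ k A≐B i j with i Finₚ.≟ k | j Finₚ.≟ k
... | yes _ | _     = cong -_ (A≐B i j)
... | no _  | yes _ = cong -_ (A≐B i j)
... | no _  | no _  = cong₂ ℤ._+_ (A≐B i j) (cong₂ mutationTerm (A≐B i k) (A≐B k j))

mutate-source : ∀ k M j → mutate k M k j ≡ - M k j
mutate-source k M j with k Finₚ.≟ k
... | yes _  = refl
... | no k≢k = contradiction refl k≢k

mutate-target : ∀ k M i → mutate k M i k ≡ - M i k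
mutate-target k M i with i Finₚ.≟ k | k Finₚ.≟ k
... | yes _ | _      = refl
... | no _  | yes _  = refl
... | no _  | no k≢k = contradiction refl k≢k

mutate-away : i ≢ k → j ≢ k → mutate k M i j ≡ M i j ℤ.+ mutationTerm (M i k) (M k j)
mutate-away {i} {k} {j} i≢k j≢k with i Finₚ.≟ k | j Finₚ.≟ k
... | yes i≡k | _       = contradiction i≡k i≢k
... | no _    | yes j≡k = contradiction j≡k j≢k
... | no _    | no _    = refl

n+n≡n*2 : ∀ n → n + n ≡ n * 2
n+n≡n*2 n = trans (cong (_+_ n) (sym (ℕₚ.+-identityʳ n))) (*-comm 2 n)

double/2 : ∀ n → (n + n) / 2 ≡ n
double/2 n = trans (cong (_/ 2) (n+n≡n*2 n)) (m*n/n≡m n 2)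

double%2 : ∀ n → (n + n) % 2 ≡ 0
double%2 n = trans (cong (_% 2) (n+n≡n*2 n)) (m*n%n≡0 n 2)

-- `/ℕ` on a negative dividend branches on the remainder, so evenness must be exhibited.
neg-double/ℕ2 : ∀ n → (- + (n + n)) /ℕ 2 ≡ - + n
neg-double/ℕ2 zero = refl
neg-double/ℕ2 n@(suc _) with (n + n) % 2 | double%2 n
... | .0 | refl = cong (-_ ∘ +_) (double/2 n)

pos-doubled-product : ∀ x y → + x ℤ.* + y ℤ.+ + x ℤ.* + y ≡ + (x * y + x * y)
pos-doubled-product x y = begin
  + x ℤ.* + y ℤ.+ + x ℤ.* + y  ≡⟨ cong₂ ℤ._+_ (ℤₚ.pos-* x y) (ℤₚ.pos-* x y) ⟨
  + (x * y) ℤ.+ + (x * y)      ≡⟨ ℤₚ.pos-+ (x * y) (x * y) ⟨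
  + (x * y + x * y)            ∎
  where open ≡-Reasoning

mutationTerm-pos : ∀ x y → mutationTerm (+ x) (+ y) ≡ + (x * y)
mutationTerm-pos x y = begin
  (+ x ℤ.* + y ℤ.+ + x ℤ.* + y) /ℕ 2  ≡⟨ cong (_/ℕ 2) (pos-doubled-product x y) ⟩
  + ((x * y + x * y) / 2)              ≡⟨ cong +_ (double/2 (x * y)) ⟩
  + (x * y)                            ∎
  where open ≡-Reasoning

mutationTerm-neg : ∀ x y → mutationTerm (- + x) (- + y) ≡ - + (x * y)
mutationTerm-neg x y = begin
  ((+ ∣ - + x ∣) ℤ.* (- + y) ℤ.+ (- + x) ℤ.* (+ ∣ - + y ∣)) /ℕ 2
    ≡⟨ cong (_/ℕ 2) (cong₂ ℤ._+_ (cong (λ a → + a ℤ.* - + y) (ℤₚ.∣-i∣≡∣i∣ (+ x)))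
                                 (cong (λ b → - + x ℤ.* + b) (ℤₚ.∣-i∣≡∣i∣ (+ y)))) ⟩
  (+ x ℤ.* - + y ℤ.+ - + x ℤ.* + y) /ℕ 2
    ≡⟨ cong (_/ℕ 2) (cong₂ ℤ._+_ (sym (ℤₚ.neg-distribʳ-* (+ x) (+ y))) (sym (ℤₚ.neg-distribˡ-* (+ x) (+ y)))) ⟩
  (- (+ x ℤ.* + y) ℤ.+ - (+ x ℤ.* + y)) /ℕ 2
    ≡⟨ cong (_/ℕ 2) (sym (ℤₚ.neg-distrib-+ (+ x ℤ.* + y) (+ x ℤ.* + y))) ⟩
  (- (+ x ℤ.* + y ℤ.+ + x ℤ.* + y)) /ℕ 2
    ≡⟨ cong (λ a → (- a) /ℕ 2) (pos-doubled-product x y) ⟩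
  (- + (x * y + x * y)) /ℕ 2
    ≡⟨ neg-double/ℕ2 (x * y) ⟩
  - + (x * y) ∎
  where open ≡-Reasoning

-a+[a+b]≡b : ∀ a b → - + a ℤ.+ + (a + b) ≡ + b
-a+[a+b]≡b a b = begin
  - + a ℤ.+ + (a + b)  ≡⟨ ℤₚ.-m+n≡n⊖m a (a + b) ⟩
  (a + b) ⊖ a          ≡⟨ ℤₚ.⊖-≥ (m≤m+n a b) ⟩
  + (a + b ∸ a)        ≡⟨ cong +_ (m+n∸m≡n a b) ⟩
  + b                  ∎
  where open ≡-Reasoning

a-[a+b]≡-b : ∀ a b → + a ℤ.+ - + (a + b) ≡ - + b
a-[a+b]≡-b a b = begin
  + a ℤ.+ - + (a + b)  ≡⟨ ℤₚ.m-n≡m⊖n a (a + b) ⟩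
  a ⊖ (a + b)          ≡⟨ ℤₚ.⊖-≤ (m≤m+n a b) ⟩
  - + (a + b ∸ a)      ≡⟨ cong (-_ ∘ +_) (m+n∸m≡n a b) ⟩
  - + b                ∎
  where open ≡-Reasoning

Arrows-mutate-source : Arrows M k j n → Arrows (mutate k M) j k n
Arrows-mutate-source {M} {k} {j} {n} (arrows e e′) = arrows
  (trans (mutate-target k M j) (trans (cong -_ e′) (ℤₚ.neg-involutive (+ n))))
  (trans (mutate-source k M j) (cong -_ e))

Arrows-mutate-target : Arrows M i k n → Arrows (mutate k M) k i n
Arrows-mutate-target {M} {i} {k} {n} (arrows e e′) = arrows
  (trans (mutate-source k M i) (trans (cong -_ e′) (ℤₚ.neg-involutive (+ n))))
  (trans (mutate-target k M i) (cong -_ e))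

-- The new weight n = x y − z is specified by z + n ≡ x y, avoiding truncated subtraction.
mutate-cycle : Cycle M u v w x y z → 1 ≤ x → 1 ≤ y → z + n ≡ x * y → Cycle (mutate v M) u w v n y x
mutate-cycle {M} {u} {v} {w} {x} {y} {z} {n} (uv , vw , arrows wu uw) 1≤x 1≤y z+n≡xy =
  arrows mutated-uw mutated-wu , Arrows-mutate-source vw , Arrows-mutate-target uv
  where
  u≢v : u ≢ v
  u≢v = Arrows⇒≢ uv 1≤x
  w≢v : w ≢ v
  w≢v = Arrows⇒≢ vw 1≤y ∘ sym
  mutated-uw : mutate v M u w ≡ + n
  mutated-uw = begin
    mutate v M u w                                   ≡⟨ mutate-away u≢v w≢v ⟩
    M u w ℤ.+ mutationTerm (M u v) (M v w)
      ≡⟨ cong₂ (λ a b → M u w ℤ.+ mutationTerm a b) (forward uv) (forward vw) ⟩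
    M u w ℤ.+ mutationTerm (+ x) (+ y)               ≡⟨ cong₂ ℤ._+_ uw (mutationTerm-pos x y) ⟩
    - + z ℤ.+ + (x * y)                              ≡⟨ cong (λ a → - + z ℤ.+ + a) (sym z+n≡xy) ⟩
    - + z ℤ.+ + (z + n)                              ≡⟨ -a+[a+b]≡b z n ⟩
    + n                                              ∎
    where open ≡-Reasoning
  mutated-wu : mutate v M w u ≡ - + n
  mutated-wu = begin
    mutate v M w u                                   ≡⟨ mutate-away w≢v u≢v ⟩
    M w u ℤ.+ mutationTerm (M w v) (M v u)
      ≡⟨ cong₂ (λ a b → M w u ℤ.+ mutationTerm a b) (backward vw) (backward uv) ⟩
    M w u ℤ.+ mutationTerm (- + y) (- + x)           ≡⟨ cong₂ ℤ._+_ wu (mutationTerm-neg y x) ⟩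
    + z ℤ.+ - + (y * x)                              ≡⟨ cong (λ a → + z ℤ.+ - + a) (trans (*-comm y x) (sym z+n≡xy)) ⟩
    + z ℤ.+ - + (z + n)                              ≡⟨ a-[a+b]≡-b z n ⟩
    - + n                                            ∎
    where open ≡-Reasoning

mutate-acyclic : Acyclic M s m t p q r → 1 ≤ p → 1 ≤ q → Cycle (mutate m M) s t m (r + p * q) q p
mutate-acyclic {M} {s} {m} {t} {p} {q} {r} (sm , mt , arrows st ts) 1≤p 1≤q =
  arrows mutated-st mutated-ts , Arrows-mutate-source mt , Arrows-mutate-target sm
  where
  s≢m : s ≢ m
  s≢m = Arrows⇒≢ sm 1≤p
  t≢m : t ≢ m
  t≢m = Arrows⇒≢ mt 1≤q ∘ sym
  mutated-st : mutate m M s t ≡ + (r + p * q)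
  mutated-st = begin
    mutate m M s t                                   ≡⟨ mutate-away s≢m t≢m ⟩
    M s t ℤ.+ mutationTerm (M s m) (M m t)
      ≡⟨ cong₂ (λ a b → M s t ℤ.+ mutationTerm a b) (forward sm) (forward mt) ⟩
    M s t ℤ.+ mutationTerm (+ p) (+ q)               ≡⟨ cong₂ ℤ._+_ st (mutationTerm-pos p q) ⟩
    + r ℤ.+ + (p * q)                                ≡⟨ ℤₚ.pos-+ r (p * q) ⟨
    + (r + p * q)                                    ∎
    where open ≡-Reasoning
  mutated-ts : mutate m M t s ≡ - + (r + p * q)
  mutated-ts = begin
    mutate m M t s                                   ≡⟨ mutate-away t≢m s≢m ⟩
    M t s ℤ.+ mutationTerm (M t m) (M m s)
      ≡⟨ cong₂ (λ a b → M t s ℤ.+ mutationTerm a b) (backward mt) (backward sm) ⟩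
    M t s ℤ.+ mutationTerm (- + q) (- + p)           ≡⟨ cong₂ ℤ._+_ ts (mutationTerm-neg q p) ⟩
    - + r ℤ.+ - + (q * p)                            ≡⟨ cong (λ a → - + r ℤ.+ - + a) (*-comm q p) ⟩
    - + r ℤ.+ - + (p * q)                            ≡⟨ ℤₚ.neg-distrib-+ (+ r) (+ (p * q)) ⟨
    - (+ r ℤ.+ + (p * q))                            ≡⟨ cong -_ (ℤₚ.pos-+ r (p * q)) ⟨
    - + (r + p * q)                                  ∎
    where open ≡-Reasoning

mutateSeq-++ : ∀ ks ks′ M → mutateSeq (ks ++ ks′) M ≡ mutateSeq ks′ (mutateSeq ks M)
mutateSeq-++ []       ks′ M = refl
mutateSeq-++ (k ∷ ks) ks′ M = mutateSeq-++ ks ks′ (mutate k M)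

mutateSeq-≐ : ∀ ks → A ≐ B → mutateSeq ks A ≐ mutateSeq ks B
mutateSeq-≐ []       A≐B = A≐B
mutateSeq-≐ (k ∷ ks) A≐B = mutateSeq-≐ ks (mutate-≐ k A≐B)

MutationInfinite-mutateSeq : ∀ ks → MutationInfinite (mutateSeq ks M) → MutationInfinite M
MutationInfinite-mutateSeq {M} ks inf N with inf N
... | f , equiv , nonIso = f , reach , nonIso
  where
  reach : ∀ a → MutEquiv M (f a)
  reach a with equiv a
  ... | ks′ , e = ks ++ ks′ , λ i j → trans (cong (λ X → X i j) (mutateSeq-++ ks ks′ M)) (e i j)

MutationInfinite-≐ : A ≐ B → MutationInfinite B → MutationInfinite A
MutationInfinite-≐ {A} A≐B inf N with inf N
... | f , equiv , nonIso = f , reach , nonIso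
  where
  reach : ∀ a → MutEquiv A (f a)
  reach a with equiv a
  ... | ks , e = ks , λ i j → trans (mutateSeq-≐ ks A≐B i j) (e i j)

-- The largest entry is an isomorphism invariant

maxOver : ∀ {d} → (Fin d → ℕ) → ℕ
maxOver {zero}  f = 0
maxOver {suc d} f = f Fin.zero ⊔ maxOver (f ∘ Fin.suc)

≤-maxOver : ∀ {d} (f : Fin d → ℕ) i → f i ≤ maxOver f
≤-maxOver f Fin.zero    = m≤m⊔n _ _
≤-maxOver f (Fin.suc i) = ≤-trans (≤-maxOver (f ∘ Fin.suc) i) (m≤n⊔m _ _)

maxOver-least : ∀ {d} (f : Fin d → ℕ) {b} → (∀ i → f i ≤ b) → maxOver f ≤ b
maxOver-least {zero}  f f≤b = z≤n
maxOver-least {suc d} f f≤b = ⊔-lub (f≤b Fin.zero) (maxOver-least (f ∘ Fin.suc) (f≤b ∘ Fin.suc))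

maxEntry : Matrix → ℕ
maxEntry M = maxOver λ i → maxOver λ j → ∣ M i j ∣

∣entry∣≤maxEntry : ∀ M i j → ∣ M i j ∣ ≤ maxEntry M
∣entry∣≤maxEntry M i j =
  ≤-trans (≤-maxOver (λ j → ∣ M i j ∣) j) (≤-maxOver (λ i → maxOver λ j → ∣ M i j ∣) i)

maxEntry-least : ∀ M {b} → (∀ i j → ∣ M i j ∣ ≤ b) → maxEntry M ≤ b
maxEntry-least M ≤b = maxOver-least _ λ i → maxOver-least _ (≤b i)

Isomorphic⇒maxEntry≡ : ∀ A B → Isomorphic A B → maxEntry A ≡ maxEntry B
Isomorphic⇒maxEntry≡ A B (σ , B∘σ≡A) = ≤-antisym
  (maxEntry-least A λ i j → subst (λ e → ∣ e ∣ ≤ maxEntry B) (B∘σ≡A i j) (∣entry∣≤maxEntry B _ _))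
  (maxEntry-least B λ i j → subst (λ e → ∣ e ∣ ≤ maxEntry A) (unpermute i j) (∣entry∣≤maxEntry A _ _))
  where
  unpermute : ∀ i j → A (σ ⟨$⟩ˡ i) (σ ⟨$⟩ˡ j) ≡ B i j
  unpermute i j = trans (sym (B∘σ≡A (σ ⟨$⟩ˡ i) (σ ⟨$⟩ˡ j))) (cong₂ B (inverseʳ σ) (inverseʳ σ))

-- Quivers with distinct largest entries are not isomorphic, so a chain of mutations along which
-- the largest entry strictly increases gives arbitrarily many isomorphism classes.
unboundedMaxEntry⇒MutationInfinite :
  (∀ b → Σ (List (Fin 4)) λ ks → b < maxEntry (mutateSeq ks M)) → MutationInfinite M
unboundedMaxEntry⇒MutationInfinite {M} unbounded N = quiver , (λ a → chain (toℕ a) , λ _ _ → refl) , nonIso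
  where
  chain : ℕ → List (Fin 4)
  size : ℕ → ℕ
  size a = maxEntry (mutateSeq (chain a) M)
  chain zero    = []
  chain (suc a) = proj₁ (unbounded (size a))
  size-< : ∀ {a b} → a < b → size a < size b
  size-< {a} {suc b} (s≤s a≤b) with m≤n⇒m<n∨m≡n a≤b
  ... | inj₁ a<b  = <-trans (size-< a<b) (proj₂ (unbounded (size b)))
  ... | inj₂ refl = proj₂ (unbounded (size a))
  quiver : Fin N → Matrix
  quiver a = mutateSeq (chain (toℕ a)) M
  nonIso : ∀ a a′ → a ≢ a′ → ¬ Isomorphic (quiver a) (quiver a′)
  nonIso a a′ a≢a′ iso with ℕₚ.<-cmp (toℕ a) (toℕ a′)
  ... | tri< a<a′ _ _ = <⇒≢ (size-< a<a′) (Isomorphic⇒maxEntry≡ (quiver a) (quiver a′) iso)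
  ... | tri≈ _ a≡a′ _ = a≢a′ (Finₚ.toℕ-injective a≡a′)
  ... | tri> _ _ a′<a = <⇒≢ (size-< a′<a) (sym (Isomorphic⇒maxEntry≡ (quiver a) (quiver a′) iso))

-- Markov cycles

record MarkovCycle (M : Matrix) : Set where
  constructor markovCycle
  field
    v₁ v₂ v₃  : Fin 4
    w₁ w₂ w₃  : ℕ
    cycle     : Cycle M v₁ v₂ v₃ w₁ w₂ w₃
    2≤w₃      : 2 ≤ w₃
    w₃≤w₁     : w₃ ≤ w₁
    w₃≤w₂     : w₃ ≤ w₂
    5≤w₁+w₂   : 5 ≤ w₁ + w₂

  size : ℕ
  size = w₁ + w₂

open MarkovCycle using (size)

ordered-markov-gap : ∀ {a b} → 2 ≤ z → z ≤ a → a ≤ b → 5 ≤ a + b → suc b + z ≤ a * b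
ordered-markov-gap {z} {suc (suc a)} {b@(suc (suc (suc _)))} _ z≤a _ _ = begin
  suc b + z            ≤⟨ +-monoʳ-≤ (suc b) z≤a ⟩
  suc b + suc (suc a)  ≡⟨ +-suc b (suc (suc a)) ⟨
  b + (3 + a)          ≤⟨ +-monoʳ-≤ b (+-mono-≤ (s≤s (s≤s (s≤s z≤n))) (m≤m*n a b)) ⟩
  b + (b + a * b)      ∎
  where open ℕₚ.≤-Reasoning
ordered-markov-gap {a = suc (suc _)} {zero}                  _ _ ()                _
ordered-markov-gap {a = suc (suc _)} {suc zero}              _ _ (s≤s ())          _
ordered-markov-gap {a = suc (suc zero)} {suc (suc zero)}     _ _ _                 (s≤s (s≤s (s≤s (s≤s ()))))
ordered-markov-gap {a = suc (suc (suc _))} {suc (suc zero)}  _ _ (s≤s (s≤s ()))    _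
ordered-markov-gap {a = zero}          2≤z z≤a _ _ = contradiction (≤-trans 2≤z z≤a) λ ()
ordered-markov-gap {a = suc zero}      2≤z z≤a _ _ = contradiction (≤-trans 2≤z z≤a) λ { (s≤s ()) }

markov-gap : 2 ≤ z → z ≤ x → z ≤ y → 5 ≤ x + y → suc (x ⊔ y) + z ≤ x * y
markov-gap {z} {x} {y} 2≤z z≤x z≤y 5≤x+y with ≤-total x y
... | inj₁ x≤y rewrite ℕₚ.m≤n⇒m⊔n≡n x≤y = ordered-markov-gap 2≤z z≤x x≤y 5≤x+y
... | inj₂ y≤x rewrite ℕₚ.m≥n⇒m⊔n≡m y≤x | *-comm x y =
  ordered-markov-gap 2≤z z≤y y≤x (subst (5 ≤_) (+-comm x y) 5≤x+y)

markov-step : (c : MarkovCycle M) → Σ (Fin 4) λ k → Σ (MarkovCycle (mutate k M)) λ c′ → size c < size c′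
markov-step {M} (markovCycle u v w x y z cyc 2≤z z≤x z≤y 5≤x+y) = v , next (≤-total x y)
  where
  N : ℕ
  N = x * y ∸ z
  gap : suc (x ⊔ y) + z ≤ x * y
  gap = markov-gap 2≤z z≤x z≤y 5≤x+y
  x⊔y<N : x ⊔ y < N
  x⊔y<N = m+n≤o⇒m≤o∸n (suc (x ⊔ y)) gap
  x<N : x < N
  x<N = ≤-trans (s≤s (m≤m⊔n x y)) x⊔y<N
  y<N : y < N
  y<N = ≤-trans (s≤s (m≤n⊔m x y)) x⊔y<N
  cyc′ : Cycle (mutate v M) u w v N y x
  cyc′ = mutate-cycle cyc (≤-trans (s≤s z≤n) (≤-trans 2≤z z≤x)) (≤-trans (s≤s z≤n) (≤-trans 2≤z z≤y))
           (m+[n∸m]≡n (≤-trans (m≤n+m z _) gap))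
  next : x ≤ y ⊎ y ≤ x → Σ (MarkovCycle (mutate v M)) λ c′ → x + y < size c′
  next (inj₁ x≤y) = markovCycle u w v N y x cyc′ (≤-trans 2≤z z≤x) (ℕₚ.<⇒≤ x<N) x≤y
                      (≤-trans 5≤x+y (ℕₚ.+-monoˡ-≤ y (ℕₚ.<⇒≤ x<N))) ,
                    +-monoˡ-< y x<N
  next (inj₂ y≤x) = markovCycle v u w x N y (Cycle-rotate (Cycle-rotate cyc′)) (≤-trans 2≤z z≤y) y≤x (ℕₚ.<⇒≤ y<N)
                      (≤-trans 5≤x+y (+-monoʳ-≤ x (ℕₚ.<⇒≤ y<N))) ,
                    +-monoʳ-< x y<N

markov-grow : ∀ b (c : MarkovCycle M) →
  Σ (List (Fin 4)) λ ks → Σ (MarkovCycle (mutateSeq ks M)) λ c′ → b + size c ≤ size c′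
markov-grow zero    c = [] , c , ≤-refl
markov-grow (suc b) c with markov-step c
... | k , c₁ , c<c₁ with markov-grow b c₁
... | ks , c₂ , b+c₁≤c₂ = k ∷ ks , c₂ , (begin
  suc b + size c    ≡⟨ +-suc b (size c) ⟨
  b + suc (size c)  ≤⟨ +-monoʳ-≤ b c<c₁ ⟩
  b + size c₁       ≤⟨ b+c₁≤c₂ ⟩
  size c₂           ∎)
  where open ℕₚ.≤-Reasoning

size≤maxEntry+maxEntry : (c : MarkovCycle M) → size c ≤ maxEntry M + maxEntry M
size≤maxEntry+maxEntry {M} (markovCycle u v w _ _ _ (uv , vw , _) _ _ _ _) =
  +-mono-≤ (subst (λ e → ∣ e ∣ ≤ maxEntry M) (forward uv) (∣entry∣≤maxEntry M u v))
           (subst (λ e → ∣ e ∣ ≤ maxEntry M) (forward vw) (∣entry∣≤maxEntry M v w))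

MarkovCycle⇒MutationInfinite : MarkovCycle M → MutationInfinite M
MarkovCycle⇒MutationInfinite {M} c = unboundedMaxEntry⇒MutationInfinite unbounded
  where
  unbounded : ∀ b → Σ (List (Fin 4)) λ ks → b < maxEntry (mutateSeq ks M)
  unbounded b with markov-grow (suc (b + b)) c
  ... | ks , c′ , grown = ks , ≰⇒> λ maxEntry≤b → ℕₚ.1+n≰n (begin
    suc (b + b)                                              ≤⟨ m≤m+n (suc (b + b)) (size c) ⟩
    suc (b + b) + size c                                     ≤⟨ grown ⟩
    size c′                                                  ≤⟨ size≤maxEntry+maxEntry c′ ⟩
    maxEntry (mutateSeq ks M) + maxEntry (mutateSeq ks M)    ≤⟨ +-mono-≤ maxEntry≤b maxEntry≤b ⟩
    b + b                                                    ∎)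
    where open ℕₚ.≤-Reasoning

-- Cyclic triangles of infinite type

-- The cyclic triangles of types (1,1,2), (1,1,1) and (2,2,2) are the mutation-finite quivers
-- of types Ã₂, A₃ and the Markov quiver.
FiniteType : ℕ → ℕ → ℕ → Set
FiniteType x y z = Is112 x y z ⊎ (x ≡ 1 × y ≡ 1 × z ≡ 1) ⊎ (x ≡ 2 × y ≡ 2 × z ≡ 2)

Avoiding : (ℕ → ℕ → ℕ → Set) → ℕ → ℕ → ℕ → Set
Avoiding P x y z = 1 ≤ x × 1 ≤ y × 1 ≤ z × ¬ P x y z

Is112-rotate : Is112 y z x → Is112 x y z
Is112-rotate (inj₁ (y≡1 , z≡1 , x≡2))        = inj₂ (inj₂ (x≡2 , y≡1 , z≡1))
Is112-rotate (inj₂ (inj₁ (y≡1 , z≡2 , x≡1))) = inj₁ (x≡1 , y≡1 , z≡2)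
Is112-rotate (inj₂ (inj₂ (y≡2 , z≡1 , x≡1))) = inj₂ (inj₁ (x≡1 , y≡2 , z≡1))

Avoiding-rotate : ∀ {P : ℕ → ℕ → ℕ → Set} → (∀ {x y z} → P y z x → P x y z) →
                  Avoiding P x y z → Avoiding P y z x
Avoiding-rotate rotate (1≤x , 1≤y , 1≤z , ¬p) = 1≤y , 1≤z , 1≤x , ¬p ∘ rotate

FiniteType⇒≤2 : FiniteType x y z → x ≤ 2 × y ≤ 2 × z ≤ 2
FiniteType⇒≤2 (inj₁ (inj₁ (refl , refl , refl)))        = s≤s z≤n , s≤s z≤n , ≤-refl
FiniteType⇒≤2 (inj₁ (inj₂ (inj₁ (refl , refl , refl)))) = s≤s z≤n , ≤-refl , s≤s z≤n
FiniteType⇒≤2 (inj₁ (inj₂ (inj₂ (refl , refl , refl)))) = ≤-refl , s≤s z≤n , s≤s z≤n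
FiniteType⇒≤2 (inj₂ (inj₁ (refl , refl , refl)))        = s≤s z≤n , s≤s z≤n , s≤s z≤n
FiniteType⇒≤2 (inj₂ (inj₂ (refl , refl , refl)))        = ≤-refl , ≤-refl , ≤-refl

≥1∧≢1⇒≥2 : 1 ≤ x → x ≢ 1 → 2 ≤ x
≥1∧≢1⇒≥2 1≤x x≢1 = ℕₚ.≤∧≢⇒< 1≤x (x≢1 ∘ sym)

≥2∧≢2⇒≥3 : 2 ≤ x → x ≢ 2 → 3 ≤ x
≥2∧≢2⇒≥3 2≤x x≢2 = ℕₚ.≤∧≢⇒< 2≤x (x≢2 ∘ sym)

5≤x+y : 2 ≤ z → z ≤ x → z ≤ y → ¬ (x ≡ 2 × y ≡ 2 × z ≡ 2) → 5 ≤ x + y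
5≤x+y {z} {x} {y} 2≤z z≤x z≤y ¬222 with x ℕₚ.≟ 2 | y ℕₚ.≟ 2
... | yes refl | yes refl = contradiction (refl , refl , ≤-antisym z≤x 2≤z) ¬222
... | no x≢2   | _        = +-mono-≤ (≥2∧≢2⇒≥3 (≤-trans 2≤z z≤x) x≢2) (≤-trans 2≤z z≤y)
... | yes refl | no y≢2   = +-monoʳ-≤ 2 (≥2∧≢2⇒≥3 (≤-trans 2≤z z≤y) y≢2)

cycle≥2⇒MutationInfinite : Cycle M u v w x y z → 2 ≤ x → 2 ≤ y → 2 ≤ z → ¬ (x ≡ 2 × y ≡ 2 × z ≡ 2) →
                           MutationInfinite M
cycle≥2⇒MutationInfinite {M} {x = x} {y} {z} c 2≤x 2≤y 2≤z ¬222 =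
  byMinimum (≤-total z x) (≤-total z y) (≤-total x y)
  where
  markov : ∀ {u v w x y z} → Cycle M u v w x y z → 2 ≤ z → z ≤ x → z ≤ y →
           ¬ (x ≡ 2 × y ≡ 2 × z ≡ 2) → MutationInfinite M
  markov c 2≤z z≤x z≤y ¬222 =
    MarkovCycle⇒MutationInfinite (markovCycle _ _ _ _ _ _ c 2≤z z≤x z≤y (5≤x+y 2≤z z≤x z≤y ¬222))
  minimal-z : z ≤ x → z ≤ y → MutationInfinite M
  minimal-z z≤x z≤y = markov c 2≤z z≤x z≤y ¬222
  minimal-x : x ≤ y → x ≤ z → MutationInfinite M
  minimal-x x≤y x≤z = markov (Cycle-rotate c) 2≤x x≤y x≤z λ (y≡2 , z≡2 , x≡2) → ¬222 (x≡2 , y≡2 , z≡2)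
  minimal-y : y ≤ z → y ≤ x → MutationInfinite M
  minimal-y y≤z y≤x =
    markov (Cycle-rotate (Cycle-rotate c)) 2≤y y≤z y≤x λ (z≡2 , x≡2 , y≡2) → ¬222 (x≡2 , y≡2 , z≡2)
  byMinimum : z ≤ x ⊎ x ≤ z → z ≤ y ⊎ y ≤ z → x ≤ y ⊎ y ≤ x → MutationInfinite M
  byMinimum (inj₁ z≤x) (inj₁ z≤y) _          = minimal-z z≤x z≤y
  byMinimum (inj₂ x≤z) _          (inj₁ x≤y) = minimal-x x≤y x≤z
  byMinimum _          (inj₂ y≤z) (inj₂ y≤x) = minimal-y y≤z y≤x
  byMinimum (inj₁ z≤x) (inj₂ y≤z) (inj₁ _)   = minimal-y y≤z (≤-trans y≤z z≤x)
  byMinimum (inj₂ x≤z) (inj₁ z≤y) (inj₂ _)   = minimal-x (≤-trans x≤z z≤y) x≤z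

cycle-1yz⇒MutationInfinite : Cycle M u v w 1 y z → 2 ≤ y → 2 ≤ z → MutationInfinite M
cycle-1yz⇒MutationInfinite {M} {u} {v} {w} {y} {z} c 2≤y 2≤z =
  MutationInfinite-mutateSeq [ w ] (cycle≥2⇒MutationInfinite c′ (≤-trans (ℕₚ.n≤1+n 2) 3≤yz-1) 2≤z 2≤y
    λ (yz-1≡2 , _) → ℕₚ.<-irrefl (sym yz-1≡2) 3≤yz-1)
  where
  4≤yz : 4 ≤ y * z
  4≤yz = ℕₚ.*-mono-≤ 2≤y 2≤z
  3≤yz-1 : 3 ≤ y * z ∸ 1
  3≤yz-1 = ℕₚ.∸-monoˡ-≤ 1 4≤yz
  c′ : Cycle (mutate w M) v u w (y * z ∸ 1) z y
  c′ = mutate-cycle (Cycle-rotate c) (≤-trans (s≤s z≤n) 2≤y) (≤-trans (s≤s z≤n) 2≤z)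
         (m+[n∸m]≡n (≤-trans (s≤s z≤n) 4≤yz))

cycle-11z⇒MutationInfinite : Cycle M u v w 1 1 z → 3 ≤ z → MutationInfinite M
cycle-11z⇒MutationInfinite {M} {u} {v} {w} {z} c 3≤z =
  MutationInfinite-mutateSeq [ w ] (cycle-1yz⇒MutationInfinite (Cycle-rotate (Cycle-rotate c′)) (ℕₚ.∸-monoˡ-≤ 1 3≤z) 2≤z)
  where
  2≤z : 2 ≤ z
  2≤z = ≤-trans (ℕₚ.n≤1+n 2) 3≤z
  c′ : Cycle (mutate w M) v u w (z ∸ 1) z 1
  c′ = mutate-cycle (Cycle-rotate c) (s≤s z≤n) (≤-trans (s≤s z≤n) 2≤z)
         (trans (m+[n∸m]≡n (≤-trans (s≤s z≤n) 2≤z)) (sym (ℕₚ.*-identityˡ z)))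

cycle⇒MutationInfinite : Cycle M u v w x y z → Avoiding FiniteType x y z → MutationInfinite M
cycle⇒MutationInfinite {x = x} {y} {z} c (1≤x , 1≤y , 1≤z , ¬finite) with x ℕₚ.≟ 1 | y ℕₚ.≟ 1 | z ℕₚ.≟ 1
... | yes refl | yes refl | yes refl = contradiction (inj₂ (inj₁ (refl , refl , refl))) ¬finite
... | yes refl | yes refl | no z≢1   = cycle-11z⇒MutationInfinite c
  (≥2∧≢2⇒≥3 (≥1∧≢1⇒≥2 1≤z z≢1) λ z≡2 → ¬finite (inj₁ (inj₁ (refl , refl , z≡2))))
... | yes refl | no y≢1   | yes refl = cycle-11z⇒MutationInfinite (Cycle-rotate (Cycle-rotate c))
  (≥2∧≢2⇒≥3 (≥1∧≢1⇒≥2 1≤y y≢1) λ y≡2 → ¬finite (inj₁ (inj₂ (inj₁ (refl , y≡2 , refl)))))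
... | no x≢1   | yes refl | yes refl = cycle-11z⇒MutationInfinite (Cycle-rotate c)
  (≥2∧≢2⇒≥3 (≥1∧≢1⇒≥2 1≤x x≢1) λ x≡2 → ¬finite (inj₁ (inj₂ (inj₂ (x≡2 , refl , refl)))))
... | yes refl | no y≢1   | no z≢1   =
  cycle-1yz⇒MutationInfinite c (≥1∧≢1⇒≥2 1≤y y≢1) (≥1∧≢1⇒≥2 1≤z z≢1)
... | no x≢1   | yes refl | no z≢1   =
  cycle-1yz⇒MutationInfinite (Cycle-rotate c) (≥1∧≢1⇒≥2 1≤z z≢1) (≥1∧≢1⇒≥2 1≤x x≢1)
... | no x≢1   | no y≢1   | yes refl =
  cycle-1yz⇒MutationInfinite (Cycle-rotate (Cycle-rotate c)) (≥1∧≢1⇒≥2 1≤x x≢1) (≥1∧≢1⇒≥2 1≤y y≢1)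
... | no x≢1   | no y≢1   | no z≢1   =
  cycle≥2⇒MutationInfinite c (≥1∧≢1⇒≥2 1≤x x≢1) (≥1∧≢1⇒≥2 1≤y y≢1) (≥1∧≢1⇒≥2 1≤z z≢1)
    (¬finite ∘ inj₂ ∘ inj₂)

heavy⇒¬FiniteType : 3 ≤ x → ¬ FiniteType x y z
heavy⇒¬FiniteType 3≤x finite = ℕₚ.<-irrefl refl (≤-trans 3≤x (proj₁ (FiniteType⇒≤2 finite)))

acyclic⇒MutationInfinite : Acyclic M s m t p q r → 1 ≤ p → 1 ≤ q → 3 ≤ r + p * q → MutationInfinite M
acyclic⇒MutationInfinite {m = m} a 1≤p 1≤q 3≤r+pq =
  MutationInfinite-mutateSeq [ m ] (cycle⇒MutationInfinite (mutate-acyclic a 1≤p 1≤q)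
    (≤-trans (s≤s z≤n) 3≤r+pq , 1≤q , 1≤p , heavy⇒¬FiniteType 3≤r+pq))

anotherVertex : ∀ (i j : Fin 4) → ∃ λ k → k ≢ i × k ≢ j
anotherVertex = toWitness
  {a? = Finₚ.all? λ i → Finₚ.all? λ j → Finₚ.any? λ k → ¬? (k Finₚ.≟ i) ×-dec ¬? (k Finₚ.≟ j)} _

m≤m*n⁺ : ∀ m {n} → 1 ≤ n → m ≤ m * n
m≤m*n⁺ m {n} 1≤n = m≤m*n m n {{>-nonZero 1≤n}}

m≤n*m⁺ : ∀ m {n} → 1 ≤ n → m ≤ n * m
m≤n*m⁺ m {n} 1≤n = ℕₚ.m≤n*m m n {{>-nonZero 1≤n}}

-- The triangle through the heavy edge and any third vertex is cyclic with a weight ≥ 3, or acyclic.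
heavyEdge⇒MutationInfinite : IsSkew M → Complete M → 3 ≤ ∣ M i j ∣ → MutationInfinite M
heavyEdge⇒MutationInfinite {M} {i} {j} skew complete 3≤a with anotherVertex i j
... | k , k≢i , k≢j = triangle (orientation skew Mij≢0) (orientation skew Mjk≢0) (orientation skew Mki≢0)
  where
  i≢j : i ≢ j
  i≢j refl = contradiction (subst (λ e → 3 ≤ ∣ e ∣) (skew⇒diagonal≡0 skew i) 3≤a) λ ()
  Mij≢0 : M i j ≢ + 0
  Mij≢0 = complete i j i≢j
  Mjk≢0 : M j k ≢ + 0
  Mjk≢0 = complete j k (k≢j ∘ sym)
  Mki≢0 : M k i ≢ + 0
  Mki≢0 = complete k i k≢i
  a b c : ℕ
  a = ∣ M i j ∣
  b = ∣ M j k ∣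
  c = ∣ M k i ∣
  1≤a : 1 ≤ a
  1≤a = ≢0⇒1≤∣∣ Mij≢0
  1≤b : 1 ≤ b
  1≤b = ≢0⇒1≤∣∣ Mjk≢0
  1≤c : 1 ≤ c
  1≤c = ≢0⇒1≤∣∣ Mki≢0
  triangle : Arrows M i j a ⊎ Arrows M j i a → Arrows M j k b ⊎ Arrows M k j b →
             Arrows M k i c ⊎ Arrows M i k c → MutationInfinite M
  triangle (inj₁ ij) (inj₁ jk) (inj₁ ki) = cycle⇒MutationInfinite (ij , jk , ki) 
    (1≤a , 1≤b , 1≤c , heavy⇒¬FiniteType 3≤a)
  triangle (inj₂ ji) (inj₂ kj) (inj₂ ik) = cycle⇒MutationInfinite (ji , ik , kj) 
    (1≤a , 1≤c , 1≤b , heavy⇒¬FiniteType 3≤a)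
  triangle (inj₁ ij) (inj₁ jk) (inj₂ ik) = acyclic⇒MutationInfinite (ij , jk , ik) 1≤a 1≤b
    (≤-trans 3≤a (≤-trans (m≤m*n⁺ a 1≤b) (m≤n+m _ c)))
  triangle (inj₁ ij) (inj₂ kj) (inj₁ ki) = acyclic⇒MutationInfinite (ki , ij , kj) 1≤c 1≤a
    (≤-trans 3≤a (≤-trans (m≤n*m⁺ a 1≤c) (m≤n+m _ b)))
  triangle (inj₁ ij) (inj₂ kj) (inj₂ ik) = acyclic⇒MutationInfinite (ik , kj , ij) 1≤c 1≤b
    (≤-trans 3≤a (m≤m+n a _))
  triangle (inj₂ ji) (inj₁ jk) (inj₁ ki) = acyclic⇒MutationInfinite (jk , ki , ji) 1≤b 1≤c
    (≤-trans 3≤a (m≤m+n a _))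
  triangle (inj₂ ji) (inj₁ jk) (inj₂ ik) = acyclic⇒MutationInfinite (ji , ik , jk) 1≤a 1≤c
    (≤-trans 3≤a (≤-trans (m≤m*n⁺ a 1≤c) (m≤n+m _ b)))
  triangle (inj₂ ji) (inj₂ kj) (inj₁ ki) = acyclic⇒MutationInfinite (kj , ji , ki) 1≤b 1≤a
    (≤-trans 3≤a (≤-trans (m≤n*m⁺ a 1≤b) (m≤n+m _ c)))

-- Quivers with all weights in {1, 2}

fromUpper : ℤ → ℤ → ℤ → ℤ → ℤ → ℤ → Matrix
fromUpper a b c d e f 0F 0F = + 0
fromUpper a b c d e f 0F 1F = a
fromUpper a b c d e f 0F 2F = b
fromUpper a b c d e f 0F 3F = c
fromUpper a b c d e f 1F 0F = - a
fromUpper a b c d e f 1F 1F = + 0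
fromUpper a b c d e f 1F 2F = d
fromUpper a b c d e f 1F 3F = e
fromUpper a b c d e f 2F 0F = - b
fromUpper a b c d e f 2F 1F = - d
fromUpper a b c d e f 2F 2F = + 0
fromUpper a b c d e f 2F 3F = f
fromUpper a b c d e f 3F 0F = - c
fromUpper a b c d e f 3F 1F = - e
fromUpper a b c d e f 3F 2F = - f
fromUpper a b c d e f 3F 3F = + 0

upperPart : Matrix → Matrix
upperPart M = fromUpper (M 0F 1F) (M 0F 2F) (M 0F 3F) (M 1F 2F) (M 1F 3F) (M 2F 3F)

skew⇒≐upperPart : IsSkew M → M ≐ upperPart M
skew⇒≐upperPart skew 0F 0F = skew⇒diagonal≡0 skew 0F
skew⇒≐upperPart skew 0F 1F = refl
skew⇒≐upperPart skew 0F 2F = refl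
skew⇒≐upperPart skew 0F 3F = refl
skew⇒≐upperPart skew 1F 0F = skew 1F 0F
skew⇒≐upperPart skew 1F 1F = skew⇒diagonal≡0 skew 1F
skew⇒≐upperPart skew 1F 2F = refl
skew⇒≐upperPart skew 1F 3F = refl
skew⇒≐upperPart skew 2F 0F = skew 2F 0F
skew⇒≐upperPart skew 2F 1F = skew 2F 1F
skew⇒≐upperPart skew 2F 2F = skew⇒diagonal≡0 skew 2F
skew⇒≐upperPart skew 2F 3F = refl
skew⇒≐upperPart skew 3F 0F = skew 3F 0F
skew⇒≐upperPart skew 3F 1F = skew 3F 1F
skew⇒≐upperPart skew 3F 2F = skew 3F 2F
skew⇒≐upperPart skew 3F 3F = skew⇒diagonal≡0 skew 3F

smallWeights : List ℤ
smallWeights = + 1 ∷ + 2 ∷ - + 1 ∷ - + 2 ∷ []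

nonzero∧≤2⇒∈smallWeights : ∀ {e} → e ≢ + 0 → ∣ e ∣ ≤ 2 → e ∈ smallWeights
nonzero∧≤2⇒∈smallWeights {+ zero}               e≢0 _ = contradiction refl e≢0
nonzero∧≤2⇒∈smallWeights {+[1+ 0 ]}             _   _ = here refl
nonzero∧≤2⇒∈smallWeights {+[1+ 1 ]}             _   _ = there (here refl)
nonzero∧≤2⇒∈smallWeights { -[1+ 0 ]}            _   _ = there (there (here refl))
nonzero∧≤2⇒∈smallWeights { -[1+ 1 ]}            _   _ = there (there (there (here refl)))
nonzero∧≤2⇒∈smallWeights {+[1+ suc (suc _) ]}   _   (s≤s (s≤s ()))
nonzero∧≤2⇒∈smallWeights { -[1+ suc (suc _) ]}  _   (s≤s (s≤s ()))

-- One rotation of each oriented triangle on [4].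
triangles : List (Fin 4 × Fin 4 × Fin 4)
triangles = (0F , 1F , 2F) ∷ (0F , 2F , 1F) ∷ (0F , 1F , 3F) ∷ (0F , 3F , 1F) ∷
            (0F , 2F , 3F) ∷ (0F , 3F , 2F) ∷ (1F , 2F , 3F) ∷ (1F , 3F , 2F) ∷ []

Rotation : Fin 4 × Fin 4 × Fin 4 → Fin 4 → Fin 4 → Fin 4 → Set
Rotation τ i j k = τ ≡ (i , j , k) ⊎ τ ≡ (j , k , i) ⊎ τ ≡ (k , i , j)

distinct⇒rotationInTriangles : ∀ i j k → i ≢ j → j ≢ k → k ≢ i → Any (λ τ → Rotation τ i j k) triangles
distinct⇒rotationInTriangles = toWitness {a? = Finₚ.all? λ i → Finₚ.all? λ j → Finₚ.all? λ k →
  ¬? (i Finₚ.≟ j) →-dec ¬? (j Finₚ.≟ k) →-dec ¬? (k Finₚ.≟ i) →-dec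
  Any.any? (λ τ → τ ≟ (i , j , k) ⊎-dec τ ≟ (j , k , i) ⊎-dec τ ≟ (k , i , j)) triangles} _
  where
  _≟_ : (τ τ′ : Fin 4 × Fin 4 × Fin 4) → Dec (τ ≡ τ′)
  _≟_ = ≡-dec Finₚ._≟_ (≡-dec Finₚ._≟_ Finₚ._≟_)

-- The weights are read off the matrix, which makes the predicate decidable.
CycleAt : (ℕ → ℕ → ℕ → Set) → Matrix → Fin 4 × Fin 4 × Fin 4 → Set
CycleAt P M (u , v , w) =
  Cycle M u v w (∣ M u v ∣) (∣ M v w ∣) (∣ M w u ∣) × P (∣ M u v ∣) (∣ M v w ∣) (∣ M w u ∣)

cycle⇒CycleAt : ∀ {P} → Cycle M u v w x y z → P x y z → CycleAt P M (u , v , w)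
cycle⇒CycleAt c@(uv , vw , wu) px with cong ∣_∣ (forward uv) | cong ∣_∣ (forward vw) | cong ∣_∣ (forward wu)
... | refl | refl | refl = c , px

cycle⇒CycleAtTriangle : Cycle M i j k x y z → Avoiding Is112 x y z → Any (CycleAt (Avoiding Is112) M) triangles
cycle⇒CycleAtTriangle {M} {i} {j} {k} c@(ij , jk , ki) avoid@(1≤x , 1≤y , 1≤z , _) =
  Any.map place (distinct⇒rotationInTriangles i j k (Arrows⇒≢ ij 1≤x) (Arrows⇒≢ jk 1≤y) (Arrows⇒≢ ki 1≤z))
  where
  place : ∀ {τ} → Rotation τ i j k → CycleAt (Avoiding Is112) M τ
  place (inj₁ refl)        = cycle⇒CycleAt c avoid
  place (inj₂ (inj₁ refl)) = cycle⇒CycleAt (Cycle-rotate c) (Avoiding-rotate Is112-rotate avoid)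
  place (inj₂ (inj₂ refl)) =
    cycle⇒CycleAt (Cycle-rotate (Cycle-rotate c)) (Avoiding-rotate Is112-rotate (Avoiding-rotate Is112-rotate avoid))

arrows? : ∀ M i j n → Dec (Arrows M i j n)
arrows? M i j n =
  map′ (λ (e , e′) → arrows e e′) (λ a → forward a , backward a) (M i j ℤₚ.≟ + n ×-dec M j i ℤₚ.≟ - + n)

avoiding? : ∀ {P} → (∀ x y z → Dec (P x y z)) → ∀ x y z → Dec (Avoiding P x y z)
avoiding? P? x y z = 1 ≤? x ×-dec 1 ≤? y ×-dec 1 ≤? z ×-dec ¬? (P? x y z)

cycleAt? : ∀ {P} → (∀ x y z → Dec (P x y z)) → ∀ M τ → Dec (CycleAt P M τ)
cycleAt? P? M (u , v , w) = (arrows? M u v _ ×-dec arrows? M v w _ ×-dec arrows? M w u _) ×-dec P? _ _ _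

is112? : ∀ x y z → Dec (Is112 x y z)
is112? x y z = (x ℕₚ.≟ 1 ×-dec y ℕₚ.≟ 1 ×-dec z ℕₚ.≟ 2) ⊎-dec
               (x ℕₚ.≟ 1 ×-dec y ℕₚ.≟ 2 ×-dec z ℕₚ.≟ 1) ⊎-dec
               (x ℕₚ.≟ 2 ×-dec y ℕₚ.≟ 1 ×-dec z ℕₚ.≟ 1)

finiteType? : ∀ x y z → Dec (FiniteType x y z)
finiteType? x y z = is112? x y z ⊎-dec (x ℕₚ.≟ 1 ×-dec y ℕₚ.≟ 1 ×-dec z ℕₚ.≟ 1) ⊎-dec
                    (x ℕₚ.≟ 2 ×-dec y ℕₚ.≟ 2 ×-dec z ℕₚ.≟ 2)

sequencesOfLength : ℕ → List (List (Fin 4))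
sequencesOfLength zero    = [ [] ]
sequencesOfLength (suc n) = concatMap (λ ks → map (_∷ ks) (0F ∷ 1F ∷ 2F ∷ 3F ∷ [])) (sequencesOfLength n)

-- Shortest sequences first, which keeps the search below fast.
sequencesUpTo : ℕ → List (List (Fin 4))
sequencesUpTo zero    = sequencesOfLength zero
sequencesUpTo (suc n) = sequencesUpTo n ++ sequencesOfLength (suc n)

ReachesInfiniteCycle : Matrix → Set
ReachesInfiniteCycle M = Any (λ ks → Any (CycleAt (Avoiding FiniteType) (mutateSeq ks M)) triangles) (sequencesUpTo 3)

reachesInfiniteCycle? : ∀ M → Dec (ReachesInfiniteCycle M)
reachesInfiniteCycle? M = Any.any? (λ ks → Any.any? (cycleAt? (avoiding? finiteType?) (mutateSeq ks M)) triangles) (sequencesUpTo 3)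

CycleNot112⇒Reaches : Matrix → Set
CycleNot112⇒Reaches M = Any (CycleAt (Avoiding Is112) M) triangles → ReachesInfiniteCycle M

cycleNot112⇒reaches? : ∀ M → Dec (CycleNot112⇒Reaches M)
cycleNot112⇒reaches? M = Any.any? (cycleAt? (avoiding? is112?) M) triangles →-dec reachesInfiniteCycle? M

allSmallQuivers : All (λ a → All (λ b → All (λ c → All (λ d → All (λ e → All (λ f →
                    CycleNot112⇒Reaches (fromUpper a b c d e f))
                  smallWeights) smallWeights) smallWeights) smallWeights) smallWeights) smallWeights
allSmallQuivers = toWitness {a? =
  All.all? (λ a → All.all? (λ b → All.all? (λ c → All.all? (λ d → All.all? (λ e → All.all? (λ f →
    cycleNot112⇒reaches? (fromUpper a b c d e f))
  smallWeights) smallWeights) smallWeights) smallWeights) smallWeights) smallWeights} _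

smallWeights⇒MutationInfinite : IsSkew M → Complete M → (∀ i j → ∣ M i j ∣ ≤ 2) →
                                Cycle M i j k x y z → Avoiding Is112 x y z → MutationInfinite M
smallWeights⇒MutationInfinite {M} skew complete ≤2 c avoid =
  MutationInfinite-≐ M≐U (fromReached (reaches (cycle⇒CycleAtTriangle (Cycle-≐ M≐U c) avoid)))
  where
  M≐U : M ≐ upperPart M
  M≐U = skew⇒≐upperPart skew
  weight : ∀ i j → i ≢ j → M i j ∈ smallWeights
  weight i j i≢j = nonzero∧≤2⇒∈smallWeights (complete i j i≢j) (≤2 i j)
  reaches : CycleNot112⇒Reaches (upperPart M)
  reaches = All.lookup (All.lookup (All.lookup (All.lookup (All.lookup (All.lookup allSmallQuivers
    (weight 0F 1F λ ())) (weight 0F 2F λ ())) (weight 0F 3F λ ())) (weight 1F 2F λ ())) (weight 1F 3F λ ())) (weight 2F 3F λ ())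
  fromReached : ReachesInfiniteCycle (upperPart M) → MutationInfinite (upperPart M)
  fromReached reached with Any.satisfied reached
  ... | ks , atTriangle with Any.satisfied atTriangle
  ...   | _ , cycle , infinite = MutationInfinite-mutateSeq ks (cycle⇒MutationInfinite cycle infinite)

bounded⊎heavy : (M : Matrix) → (∀ i j → ∣ M i j ∣ ≤ 2) ⊎ Σ (Fin 4 × Fin 4) λ (i , j) → 3 ≤ ∣ M i j ∣
bounded⊎heavy M with Finₚ.all? (λ i → Finₚ.all? λ j → ∣ M i j ∣ ≤? 2)
... | yes bounded = inj₁ bounded
... | no unbounded
  with Finₚ.¬∀⟶∃¬ 4 (λ i → ∀ j → ∣ M i j ∣ ≤ 2) (λ i → Finₚ.all? λ j → ∣ M i j ∣ ≤? 2) unbounded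
...   | i , unboundedRow with Finₚ.¬∀⟶∃¬ 4 (λ j → ∣ M i j ∣ ≤ 2) (λ j → ∣ M i j ∣ ≤? 2) unboundedRow
...     | j , ¬≤2 = inj₂ ((i , j) , ≰⇒> ¬≤2)

corollary4p5 : (Q : Matrix) → IsSkew Q → Complete Q →
    Σ ℕ (λ a → Σ ℕ (λ b → Σ ℕ (λ c → CyclicTriangle Q a b c × ¬ Is112 a b c))) →
    MutationInfinite Q
corollary4p5 Q skew complete (a , b , c , (1≤a , 1≤b , 1≤c , i , j , k , ij , jk , ki) , ¬112)
  with bounded⊎heavy Q
... | inj₁ bounded = smallWeights⇒MutationInfinite skew complete bounded
  (skew⇒Arrows skew ij , skew⇒Arrows skew jk , skew⇒Arrows skew ki) (1≤a , 1≤b , 1≤c , ¬112)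
... | inj₂ (_ , heavy) = heavyEdge⇒MutationInfinite skew complete heavy
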